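{- Let $F$ be a field, $V$ a set, and $\mathcal{L}_\bullet(T):V\to1+T\cdot F[T]$ a stratification with $\mathcal{L}(T)=N(T)/D(T)$ for some polynomials $N(T),D(T)\in1+T\cdot F[T]$ of degrees $n,d$ respectively, satisfying the functional equation $$\mathcal{L}(T)=\epsilon\cdot T^{n-d}\cdot\mathcal{L}(f/T)^c$$ for some $\epsilon,f\in F$ and some field endomorphism $c:F\to F$ (applied to coefficients). Let $m,n'\in\mathbb{N}$ with $m\le\lfloor n/2\rfloor\le n'\le n$. Then Algorithm B with inputs $(\mathcal{L}_\bullet(T),D(T),m,\lfloor n/2\rfloor,n',f,c)$ outputs a polynomial $P(T)\in1+T\cdot F[T]$ of degree at most $n'$ with $[P(T)]_{\lfloor n/2\rfloor}=[N(T)]_{\lfloor n/2\rfloor}$, together with elements $M_0,\dots,M_m\in F$ such that $N_{n-k}=\epsilon M_k$ for all $k\in\{0,\dots,m\}$.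
   Context: For $P(T)\in F[[T]]$, $P_i$ is its $i$-th coefficient and $[P(T)]_i=\sum_{k\le i}P_kT^k$. A stratification is a function $\mathcal{L}_\bullet(T):V\to1+TF[T]$ such that each $V_i=\{v:\mathcal{L}_v(T)_i\ne0,\ [\mathcal{L}_v(T)]_{i-1}=1\}$ is finite; $\mathcal{L}(T)=\prod_{v\in V}\mathcal{L}_v(T)^{ -1}\in1+TF[[T]]$. Algorithm A on $(\mathcal{L}_\bullet,D,n_0,n_1,n')$: start with $P=1$; for $i=n_0,\dots,n_1$ and $v\in V_i$ set $P:=[P\cdot[\mathcal{L}_v]_{n'}]_{n'}$; then $P:=[P^{ -1}]_{n'}$; return $[P\cdot[D]_{n'}]_{n'}$. Algorithm B on $(\mathcal{L}_\bullet,D,m,n_1,n',f,c)$ with $m\le n_1\le n'$: (1) run Algorithm A on $(\mathcal{L}_\bullet,D,1,n_1,n')$, obtaining $P(T)$; (2) $d:=\deg D$; (3) for $k=0,\dots,m$: set $h:=1$, $k':=\min(d,k)$, $M_k:=0$; for $i=0,\dots,k$: if $0\le k-i\le k'$ then $M_k:=M_k+P_i^c D_{d-(k-i)}h$; if $1\le i\le k'$ then $M_k:=M_k-M_{k-i}D_i^c h$; then $h:=hf$; (4) return $(P(T),M_0,\dots,M_m)$. -}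

module Defs where

open import Level using (Level; _⊔_)
open import Data.Nat as ℕ using (ℕ; zero; suc; _∸_; _≤_; _<_; _≤?_)
open import Data.Bool using (if_then_else_; _∧_)
open import Data.Product using (Σ; _×_; _,_; proj₁; proj₂)
open import Data.List using (List; []; _∷_; _++_; foldl; concatMap; map; upTo; length)
open import Data.List.Membership.Propositional using (_∈_)
open import Data.List.Relation.Unary.Unique.Propositional using (Unique)
open import Relation.Nullary using (¬_; does)
open import Data.Empty using (⊥)
open import Function.Bundles using (_⇔_)
open import Algebra.Bundles using (CommutativeRing)
open import Algebra.Morphism.Structures using (module RingMorphisms)

record Field (c ℓ : Level) : Set (Level.suc (c ⊔ ℓ)) where
  field
    commutativeRing : CommutativeRing c ℓ
  open CommutativeRing commutativeRing public
  field
    1≉0     : ¬ (1# ≈ 0#)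
    inverse : ∀ x → ¬ (x ≈ 0#) → Σ Carrier (λ y → x * y ≈ 1#)

module Ops {c ℓ : Level} (F : Field c ℓ) where
  open Field F

  IsFieldEndo : (Carrier → Carrier) → Set (c ⊔ ℓ)
  IsFieldEndo σ = RingMorphisms.IsRingHomomorphism rawRing rawRing σ

  pow : Carrier → ℕ → Carrier
  pow x zero    = 1#
  pow x (suc k) = pow x k * x

  Series : Set c
  Series = ℕ → Carrier

  -- polynomials in F[T] are coefficient lists (constant term first);
  -- coef p i is the i-th coefficient (0 beyond the list)
  coef : List Carrier → Series
  coef []       _       = 0#
  coef (a ∷ as) zero    = a
  coef (a ∷ as) (suc i) = coef as i

  -- degree of a polynomial given by a list with nonzero last entry
  deg : List Carrier → ℕ
  deg p = length p ∸ 1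

  sumTo : ℕ → (ℕ → Carrier) → Carrier
  sumTo zero    g = g 0
  sumTo (suc k) g = sumTo k g + g (suc k)

  one : Series
  one zero    = 1#
  one (suc _) = 0#

  mul : Series → Series → Series
  mul a b k = sumTo k (λ i → a i * b (k ∸ i))

  trunc : ℕ → Series → Series
  trunc n a k = if does (k ≤? n) then a k else 0#

  -- inverse of a power series with constant term 1:
  -- invRev a k = [b_k , … , b_0], where b = a⁻¹
  invRev : Series → ℕ → List Carrier
  invRev a zero    = 1# ∷ []
  invRev a (suc k) =
    (- sumTo k (λ j → a (suc j) * coef (invRev a k) j)) ∷ invRev a k

  inv : Series → Series
  inv a k = coef (invRev a k) 0

  -- conjugate (apply σ to coefficients) and "T^e · P^σ(f/T)" for a
  -- polynomial P of degree ≤ e:  coefficient k is σ(P_{e-k}) f^{e-k}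
  dual : (Carrier → Carrier) → Carrier → ℕ → List Carrier → Series
  dual σ f e p k = if does (k ≤? e) then σ (coef p (e ∸ k)) * pow f (e ∸ k) else 0#

  range : ℕ → ℕ → List ℕ
  range n₀ n₁ = map (n₀ ℕ.+_) (upTo (suc n₁ ∸ n₀))

  -- v ∈ V_i  :⇔  L_v(T)_i ≠ 0 and [L_v(T)]_{i-1} = 1
  -- ([L_v]_{-1} = 0 ≠ 1, so V_0 = ∅)
  InStratum : List Carrier → ℕ → Set ℓ
  InStratum p zero    = Level.Lift ℓ ⊥
  InStratum p (suc i) =
    (¬ (coef p (suc i) ≈ 0#)) × (∀ k → trunc i (coef p) k ≈ one k)

  -- A stratification L_• : V → 1 + T F[T]; finiteness of each V_i is
  -- witnessed by a duplicate-free list enumerating exactly V_i.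
  record Stratification {v : Level} (V : Set v) : Set (c ⊔ ℓ ⊔ v) where
    field
      L        : V → List Carrier
      L-const  : ∀ x → coef (L x) 0 ≈ 1#
      stratum  : ℕ → List V
      stratum-unique : ∀ i → Unique (stratum i)
      stratum-spec   : ∀ i x → (x ∈ stratum i) ⇔ InStratum (L x) i

  module _ {v : Level} {V : Set v} (S : Stratification V) where
    open Stratification S

    strata : ℕ → ℕ → List V
    strata n₀ n₁ = concatMap stratum (range n₀ n₁)

    -- L(T) = ∏_{v∈V} L_v(T)^{-1}  (T-adically convergent product):
    -- its k-th coefficient is that of (∏_{v ∈ V_1 ∪ … ∪ V_k} L_v)^{-1},
    -- all other factors being ≡ 1 mod T^{k+1}.
    Lser : Series
    Lser k = inv (foldl (λ P x → mul P (coef (L x))) one (strata 1 k)) k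

    algA : List Carrier → ℕ → ℕ → ℕ → Series
    algA D n₀ n₁ n' =
      let P₁ = foldl (λ P x → trunc n' (mul P (trunc n' (coef (L x)))))
                     one (strata n₀ n₁)
          P₂ = trunc n' (inv P₁)
      in trunc n' (mul P₂ (trunc n' (coef D)))

    module AlgB (D : List Carrier) (n₁ n' : ℕ) (f : Carrier)
                (σ : Carrier → Carrier) where
      P : Series
      P = algA D 1 n₁ n'

      d : ℕ
      d = deg D

      -- one pass of the inner loop (index i) for a given k, with state (M_k , h);
      -- prev j = M_j for j < k
      body : (ℕ → Carrier) → ℕ → Carrier × Carrier → ℕ → Carrier × Carrier
      body prev k (M , h) i =
        let k' = ℕ._⊓_ d k
            M₁ = if does (i ≤? k) ∧ does (k ∸ i ≤? k')
                   then M + (σ (P i) * coef D (d ∸ (k ∸ i))) * h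
                   else M
            M₂ = if does (1 ≤? i) ∧ does (i ≤? k')
                   then M₁ - (prev (k ∸ i) * σ (coef D i)) * h
                   else M₁
        in (M₂ , h * f)

      Mk : (ℕ → Carrier) → ℕ → Carrier
      Mk prev k = proj₁ (foldl (body prev k) (0# , 1#) (upTo (suc k)))

      -- Ms k = [M_0 , … , M_{k-1}]
      Ms : ℕ → List Carrier
      Ms zero    = []
      Ms (suc k) = Ms k ++ (Mk (coef (Ms k)) k ∷ [])

    algB : List Carrier → ℕ → ℕ → ℕ → Carrier → (Carrier → Carrier)
         → Series × List Carrier
    algB D m n₁ n' f σ = AlgB.P D n₁ n' f σ , AlgB.Ms D n₁ n' f σ (suc m)

-- Truncating mod T^{n'+1} does not change the coefficients of products and inverses
-- up to T^{n'}, and the factors L_v with v ∈ V_i, i > k, are ≡ 1 mod T^{k+1}; hence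
-- Algorithm A computes D(T)·L(T) = N(T) correctly up to degree ⌊n/2⌋.
-- For the top coefficients compare the coefficients of T^{n-k+d} on both sides of
-- N(T)·T^d D^σ(f/T) = ε·T^n N^σ(f/T)·D(T).  Only the indices j ≤ d ⊓ k contribute: the
-- left side is N_{n-k} plus terms N_{n-k+j} (j ≥ 1), the right side involves only
-- N_0, …, N_k, which are coefficients of P since k ≤ ⌊n/2⌋.  By strong induction
-- N_{n-k+j} = ε M_{k-j}, and what remains is the sum the inner loop of Algorithm B
-- computes as M_k.
module Submission where

open import Defs
open import Level using (Level)
open import Data.Nat using (ℕ; suc; _∸_; _≤_; _<_; ⌊_/2⌋)
open import Data.List using (List; length)
open import Data.Product using (_×_; proj₁; proj₂)
open import Relation.Nullary using (¬_)
open import Relation.Binary.PropositionalEquality using (_≡_)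

open import Data.Nat using (zero; z≤n; s≤s; _≤?_; _⊓_) renaming (_+_ to _+ℕ_)
open import Data.Nat.Properties as ℕₚ using (≤-refl; ≤-trans; m≤n⇒m≤1+n)
open import Data.Nat.Induction using (<-rec)
open import Data.Bool using (true; false; if_then_else_; _∧_)
open import Data.List using ([]; _∷_; _++_; _∷ʳ_; foldl; map; upTo; concatMap)
import Data.List.Properties as Listₚ
open import Data.List.Relation.Unary.All as All using (All; []; _∷_)
open import Data.Product using (_,_)
open import Data.Sum using (inj₁; inj₂)
open import Relation.Nullary using (does)
open import Relation.Nullary.Decidable using (dec-true; dec-false)
import Relation.Binary.PropositionalEquality as ≡
open import Function.Bundles using (Equivalence)
open import Algebra.Morphism.Structures using (module RingMorphisms)

m∸[n∸o]≡m∸n+o : ∀ {j k n} → j ≤ k → k ≤ n → n ∸ (k ∸ j) ≡ (n ∸ k) +ℕ j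
m∸[n∸o]≡m∸n+o {j} {k} {n} j≤k k≤n = begin
  n ∸ (k ∸ j)                   ≡⟨ ≡.cong (_∸ (k ∸ j)) (≡.sym (ℕₚ.m∸n+n≡m k≤n)) ⟩
  (n ∸ k) +ℕ k ∸ (k ∸ j)         ≡⟨ ℕₚ.+-∸-assoc (n ∸ k) (ℕₚ.m∸n≤m k j) ⟩
  (n ∸ k) +ℕ (k ∸ (k ∸ j))       ≡⟨ ≡.cong ((n ∸ k) +ℕ_) (ℕₚ.m∸[m∸n]≡n j≤k) ⟩
  (n ∸ k) +ℕ j                   ∎
  where open ≡.≡-Reasoning

module PowerSeries {c ℓ : Level} (F : Field c ℓ) where
  open Field F hiding (zero)
  open Ops F
  open import Relation.Binary.Reasoning.Setoid setoid
  open import Algebra.Properties.Ring ring using (-‿+-comm)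
  open import Algebra.Properties.CommutativeSemigroup +-commutativeSemigroup using (interchange)

  infix 4 _≈[_]_
  _≈[_]_ : Series → ℕ → Series → Set ℓ
  a ≈[ k ] b = ∀ j → j ≤ k → a j ≈ b j

  ≈[]-sym : ∀ {a b k} → a ≈[ k ] b → b ≈[ k ] a
  ≈[]-sym a≈b j j≤k = sym (a≈b j j≤k)

  ≈[]-trans : ∀ {a b e k} → a ≈[ k ] b → b ≈[ k ] e → a ≈[ k ] e
  ≈[]-trans a≈b b≈e j j≤k = trans (a≈b j j≤k) (b≈e j j≤k)

  ≈[]-weaken : ∀ {a b j k} → a ≈[ k ] b → j ≤ k → a ≈[ j ] b
  ≈[]-weaken a≈b j≤k i i≤j = a≈b i (≤-trans i≤j j≤k)

  trunc-≈[] : ∀ n a → trunc n a ≈[ n ] a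
  trunc-≈[] n a k k≤n rewrite dec-true (k ≤? n) k≤n = refl

  trunc-> : ∀ n a {k} → n < k → trunc n a k ≈ 0#
  trunc-> n a {k} n<k rewrite dec-false (k ≤? n) (ℕₚ.<⇒≱ n<k) = refl

  dual-≤ : ∀ σ f e p {k} → k ≤ e → dual σ f e p k ≡ σ (coef p (e ∸ k)) * pow f (e ∸ k)
  dual-≤ σ f e p {k} k≤e rewrite dec-true (k ≤? e) k≤e = ≡.refl

  dual-> : ∀ σ f e p {k} → e < k → dual σ f e p k ≈ 0#
  dual-> σ f e p {k} e<k rewrite dec-false (k ≤? e) (ℕₚ.<⇒≱ e<k) = refl

  coef-beyond : ∀ p {i} → length p ≤ i → coef p i ≈ 0#
  coef-beyond []       _         = refl
  coef-beyond (x ∷ xs) (s≤s l≤i) = coef-beyond xs l≤i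

  coef-beyond-deg : ∀ p {i} → deg p < i → coef p i ≈ 0#
  coef-beyond-deg []       _   = refl
  coef-beyond-deg (x ∷ xs) (s≤s l≤i) = coef-beyond xs l≤i

  coef-++ˡ : ∀ xs ys {i} → i < length xs → coef (xs ++ ys) i ≡ coef xs i
  coef-++ˡ (x ∷ xs) ys {zero}  _         = ≡.refl
  coef-++ˡ (x ∷ xs) ys {suc i} (s≤s i<l) = coef-++ˡ xs ys i<l

  coef-∷ʳ : ∀ xs y → coef (xs ∷ʳ y) (length xs) ≡ y
  coef-∷ʳ []       y = ≡.refl
  coef-∷ʳ (x ∷ xs) y = coef-∷ʳ xs y

  sumTo-cong : ∀ k {g h} → g ≈[ k ] h → sumTo k g ≈ sumTo k h
  sumTo-cong zero    g≈h = g≈h 0 z≤n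
  sumTo-cong (suc k) g≈h =
    +-cong (sumTo-cong k (≈[]-weaken g≈h (m≤n⇒m≤1+n ≤-refl))) (g≈h (suc k) ≤-refl)

  sumTo-zero : ∀ k {g} → (∀ j → j ≤ k → g j ≈ 0#) → sumTo k g ≈ 0#
  sumTo-zero zero    g≈0 = g≈0 0 z≤n
  sumTo-zero (suc k) g≈0 = begin
    sumTo k _ + _ ≈⟨ +-cong (sumTo-zero k (λ j j≤k → g≈0 j (m≤n⇒m≤1+n j≤k))) (g≈0 (suc k) ≤-refl) ⟩
    0# + 0#       ≈⟨ +-identityʳ 0# ⟩
    0#            ∎

  sumTo-head : ∀ k g → sumTo (suc k) g ≈ g 0 + sumTo k (λ j → g (suc j))
  sumTo-head zero    g = refl
  sumTo-head (suc k) g = trans (+-congʳ (sumTo-head k g)) (+-assoc _ _ _)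

  sumTo-drop : ∀ p k g → (∀ i → i < p → g i ≈ 0#) → sumTo (p +ℕ k) g ≈ sumTo k (λ j → g (p +ℕ j))
  sumTo-drop zero    k g _   = refl
  sumTo-drop (suc p) k g g≈0 = begin
    sumTo (suc (p +ℕ k)) g                        ≈⟨ sumTo-head (p +ℕ k) g ⟩
    g 0 + sumTo (p +ℕ k) (λ j → g (suc j))        ≈⟨ +-cong (g≈0 0 (s≤s z≤n)) (sumTo-drop p k _ (λ i i<p → g≈0 (suc i) (s≤s i<p))) ⟩
    0# + sumTo k (λ j → g (suc (p +ℕ j)))         ≈⟨ +-identityˡ _ ⟩
    sumTo k (λ j → g (suc p +ℕ j))                ∎

  sumTo-take : ∀ {k K} g → k ≤ K → (∀ j → k < j → j ≤ K → g j ≈ 0#) → sumTo K g ≈ sumTo k g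
  sumTo-take     {K = zero}  g z≤n _   = refl
  sumTo-take {k} {K = suc K} g k≤K g≈0 with ℕₚ.m≤n⇒m<n∨m≡n k≤K
  ... | inj₂ ≡.refl       = refl
  ... | inj₁ (s≤s k≤K') = begin
    sumTo K g + g (suc K) ≈⟨ +-cong (sumTo-take g k≤K' (λ j k<j j≤K → g≈0 j k<j (m≤n⇒m≤1+n j≤K))) (g≈0 (suc K) (s≤s k≤K') ≤-refl) ⟩
    sumTo k g + 0#        ≈⟨ +-identityʳ _ ⟩
    sumTo k g             ∎

  sumTo-reverse : ∀ k g → sumTo k g ≈ sumTo k (λ j → g (k ∸ j))
  sumTo-reverse zero    g = refl
  sumTo-reverse (suc k) g = begin
    sumTo k g + g (suc k)                           ≈⟨ +-congʳ (sumTo-reverse k g) ⟩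
    sumTo k (λ j → g (k ∸ j)) + g (suc k)           ≈⟨ +-comm _ _ ⟩
    g (suc k) + sumTo k (λ j → g (suc k ∸ suc j))   ≈⟨ sumTo-head k (λ j → g (suc k ∸ j)) ⟨
    sumTo (suc k) (λ j → g (suc k ∸ j))             ∎

  sumTo-split-head : ∀ k g → sumTo k g ≈ g 0 + sumTo k (λ j → if does (1 ≤? j) then g j else 0#)
  sumTo-split-head zero    g = sym (+-identityʳ _)
  sumTo-split-head (suc k) g = trans (+-congʳ (sumTo-split-head k g)) (+-assoc _ _ _)

  sumTo-- : ∀ k a b → sumTo k (λ i → a i - b i) ≈ sumTo k a - sumTo k b
  sumTo-- zero    a b = refl
  sumTo-- (suc k) a b = begin
    sumTo k (λ i → a i - b i) + (a (suc k) - b (suc k))     ≈⟨ +-congʳ (sumTo-- k a b) ⟩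
    (sumTo k a - sumTo k b) + (a (suc k) - b (suc k))       ≈⟨ interchange _ _ _ _ ⟩
    (sumTo k a + a (suc k)) + (- sumTo k b - b (suc k))     ≈⟨ +-congˡ (-‿+-comm _ _) ⟩
    (sumTo k a + a (suc k)) - (sumTo k b + b (suc k))       ∎

  *-sumTo : ∀ k x g → x * sumTo k g ≈ sumTo k (λ i → x * g i)
  *-sumTo zero    x g = refl
  *-sumTo (suc k) x g = trans (distribˡ x _ _) (+-congʳ (*-sumTo k x g))

  mul-cong : ∀ k {a a′ b b′} → a ≈[ k ] a′ → b ≈[ k ] b′ → mul a b k ≈ mul a′ b′ k
  mul-cong k a≈a′ b≈b′ = sumTo-cong k (λ i i≤k → *-cong (a≈a′ i i≤k) (b≈b′ (k ∸ i) (ℕₚ.m∸n≤m k i)))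

  mul-identityʳ : ∀ a k → mul a one k ≈ a k
  mul-identityʳ a zero    = *-identityʳ _
  mul-identityʳ a (suc k) = begin
    sumTo k (λ i → a i * one (suc k ∸ i)) + a (suc k) * one (suc k ∸ suc k)
      ≈⟨ +-cong (sumTo-zero k (λ i i≤k → trans (*-congˡ (reflexive (≡.cong one (ℕₚ.+-∸-assoc 1 i≤k)))) (zeroʳ _)))
                (trans (*-congˡ (reflexive (≡.cong one (ℕₚ.n∸n≡0 k)))) (*-identityʳ _)) ⟩
    0# + a (suc k)
      ≈⟨ +-identityˡ _ ⟩
    a (suc k) ∎

  mul-window : ∀ p k d a b → (∀ i → p +ℕ k < i → a i ≈ 0#) → (∀ i → d < i → b i ≈ 0#) →
               mul a b (p +ℕ d) ≈ sumTo (d ⊓ k) (λ j → a (p +ℕ j) * b (d ∸ j))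
  mul-window p k d a b a≈0 b≈0 = begin
    mul a b (p +ℕ d)
      ≈⟨ sumTo-drop p d _ (λ i i<p → trans (*-congˡ (b≈0 _ (d<p+d∸i i<p))) (zeroʳ _)) ⟩
    sumTo d (λ j → a (p +ℕ j) * b (p +ℕ d ∸ (p +ℕ j)))
      ≈⟨ sumTo-cong d (λ j _ → *-congˡ (reflexive (≡.cong b (ℕₚ.[m+n]∸[m+o]≡n∸o p d j)))) ⟩
    sumTo d (λ j → a (p +ℕ j) * b (d ∸ j))
      ≈⟨ sumTo-take _ (ℕₚ.m⊓n≤m d k) (λ j d⊓k<j j≤d → trans (*-congʳ (a≈0 _ (ℕₚ.+-monoʳ-< p (k<j d⊓k<j j≤d)))) (zeroˡ _)) ⟩
    sumTo (d ⊓ k) (λ j → a (p +ℕ j) * b (d ∸ j))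
      ∎
    where
    d<p+d∸i : ∀ {i} → i < p → d < p +ℕ d ∸ i
    d<p+d∸i {i} i<p rewrite ℕₚ.+-∸-comm d (ℕₚ.<⇒≤ i<p) = ℕₚ.+-monoˡ-≤ d (ℕₚ.m<n⇒0<n∸m i<p)
    k<j : ∀ {j} → d ⊓ k < j → j ≤ d → k < j
    k<j d⊓k<j j≤d = ℕₚ.≰⇒> (λ j≤k → ℕₚ.<⇒≱ d⊓k<j (ℕₚ.⊓-glb j≤d j≤k))

  invRev-cong : ∀ k {a b} → a ≈[ k ] b → coef (invRev a k) ≈[ k ] coef (invRev b k)
  invRev-cong zero    a≈b zero    _ = refl
  invRev-cong (suc k) a≈b zero    _ =
    -‿cong (sumTo-cong k (λ j j≤k → *-cong (a≈b (suc j) (s≤s j≤k)) (invRev-cong k a≈b′ j j≤k)))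
    where a≈b′ = ≈[]-weaken a≈b (m≤n⇒m≤1+n ≤-refl)
  invRev-cong (suc k) a≈b (suc t) (s≤s t≤k) =
    invRev-cong k (≈[]-weaken a≈b (m≤n⇒m≤1+n ≤-refl)) t t≤k

  inv-cong : ∀ k {a b} → a ≈[ k ] b → inv a k ≈ inv b k
  inv-cong k a≈b = invRev-cong k a≈b 0 z≤n

module AlgorithmA {c ℓ v : Level} (F : Field c ℓ) {V : Set v} (S : Ops.Stratification F V) where
  open Field F hiding (zero)
  open Ops F
  open PowerSeries F
  open Stratification S

  mulFactor : Series → V → Series
  mulFactor P x = mul P (coef (L x))

  mulFactorTrunc : ℕ → Series → V → Series
  mulFactorTrunc n′ P x = trunc n′ (mul P (trunc n′ (coef (L x))))

  partialProduct : ℕ → Series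
  partialProduct K = foldl mulFactor one (strata S 1 K)

  strata-suc : ∀ K → strata S 1 (suc K) ≡ strata S 1 K ++ stratum (suc K) ++ []
  strata-suc K = begin
    concatMap stratum (map suc (upTo (suc K)))          ≡⟨ ≡.cong (λ is → concatMap stratum (map suc is)) (≡.sym (Listₚ.upTo-∷ʳ K)) ⟩
    concatMap stratum (map suc (upTo K ∷ʳ K))           ≡⟨ ≡.cong (concatMap stratum) (Listₚ.map-++ suc (upTo K) (K ∷ [])) ⟩
    concatMap stratum (map suc (upTo K) ∷ʳ suc K)       ≡⟨ Listₚ.concatMap-++ stratum (map suc (upTo K)) (suc K ∷ []) ⟩
    strata S 1 K ++ stratum (suc K) ++ []               ∎
    where open ≡.≡-Reasoning

  stratum-≡1 : ∀ K → All (λ x → coef (L x) ≈[ K ] one) (stratum (suc K))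
  stratum-≡1 K = All.tabulate λ {x} x∈ j j≤K →
    trans (sym (trunc-≈[] K (coef (L x)) j j≤K)) (proj₂ (Equivalence.to (stratum-spec (suc K) x) x∈) j)

  foldl-mulFactor-≡1 : ∀ {k} P xs → All (λ x → coef (L x) ≈[ k ] one) xs → foldl mulFactor P xs ≈[ k ] P
  foldl-mulFactor-≡1 P []       []         = λ _ _ → refl
  foldl-mulFactor-≡1 P (x ∷ xs) (x≡1 ∷ xs≡1) = ≈[]-trans (foldl-mulFactor-≡1 (mulFactor P x) xs xs≡1)
    (λ t t≤k → trans (mul-cong t (λ _ _ → refl) (≈[]-weaken x≡1 t≤k)) (mul-identityʳ P t))

  partialProduct-suc : ∀ K → partialProduct (suc K) ≈[ K ] partialProduct K
  partialProduct-suc K rewrite strata-suc K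
                             | Listₚ.foldl-++ mulFactor one (strata S 1 K) (stratum (suc K) ++ []) =
    foldl-mulFactor-≡1 (partialProduct K) _ (All.++⁺ (stratum-≡1 K) [])
    where import Data.List.Relation.Unary.All.Properties as All

  partialProduct-stable : ∀ {j K} → j ≤ K → partialProduct K ≈[ j ] partialProduct j
  partialProduct-stable {K = K} j≤K with ℕₚ.m≤n⇒m<n∨m≡n j≤K
  ... | inj₂ ≡.refl = λ _ _ → refl
  ... | inj₁ (s≤s {n = K′} j≤K′) =
    ≈[]-trans (≈[]-weaken (partialProduct-suc K′) j≤K′) (partialProduct-stable j≤K′)

  foldl-mulFactorTrunc : ∀ n′ xs {P P′} → P ≈[ n′ ] P′ →
                         foldl (mulFactorTrunc n′) P xs ≈[ n′ ] foldl mulFactor P′ xs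
  foldl-mulFactorTrunc n′ []       P≈P′ = P≈P′
  foldl-mulFactorTrunc n′ (x ∷ xs) {P} P≈P′ = foldl-mulFactorTrunc n′ xs λ j j≤n′ →
    trans (trunc-≈[] n′ (mul P (trunc n′ (coef (L x)))) j j≤n′)
      (mul-cong j (≈[]-weaken P≈P′ j≤n′) (≈[]-weaken (trunc-≈[] n′ (coef (L x))) j≤n′))

  Lser-≈[]-inv : ∀ {n₁ n′} → n₁ ≤ n′ →
                 Lser S ≈[ n₁ ] inv (foldl (mulFactorTrunc n′) one (strata S 1 n₁))
  Lser-≈[]-inv {n₁} n₁≤n′ t t≤n₁ = inv-cong t (≈[]-trans
    (≈[]-sym (partialProduct-stable t≤n₁))
    (≈[]-weaken (≈[]-sym (foldl-mulFactorTrunc _ (strata S 1 n₁) (λ _ _ → refl))) (≤-trans t≤n₁ n₁≤n′)))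

  module _ (D : List Carrier) {n₁ n′ : ℕ} (n₁≤n′ : n₁ ≤ n′) where
    private
      product : Series
      product = foldl (mulFactorTrunc n′) one (strata S 1 n₁)

      P⁻¹ : Series
      P⁻¹ = trunc n′ (inv product)

      D′ : Series
      D′ = trunc n′ (coef D)

    algA-constant : coef D 0 ≈ 1# → algA S D 1 n₁ n′ 0 ≈ 1#
    algA-constant D₀≈1 = begin
      algA S D 1 n₁ n′ 0              ≈⟨ trunc-≈[] n′ (mul P⁻¹ D′) 0 z≤n ⟩
      P⁻¹ 0 * D′ 0                    ≈⟨ *-cong (trunc-≈[] n′ (inv product) 0 z≤n) (trans (trunc-≈[] n′ (coef D) 0 z≤n) D₀≈1) ⟩
      1# * 1#                         ≈⟨ *-identityʳ 1# ⟩
      1#                              ∎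
      where open import Relation.Binary.Reasoning.Setoid setoid

    algA-degree : ∀ {k} → n′ < k → algA S D 1 n₁ n′ k ≈ 0#
    algA-degree = trunc-> n′ (mul P⁻¹ D′)

    algA-≈[]-mul-Lser : algA S D 1 n₁ n′ ≈[ n₁ ] mul (Lser S) (coef D)
    algA-≈[]-mul-Lser k k≤n₁ = trans (trunc-≈[] n′ (mul P⁻¹ D′) k k≤n′)
      (mul-cong k (λ t t≤k → trans (trunc-≈[] n′ (inv product) t (≤-trans t≤k k≤n′)) (sym (Lser-≈[]-inv n₁≤n′ t (≤-trans t≤k k≤n₁))))
                  (λ t t≤k → trunc-≈[] n′ (coef D) t (≤-trans t≤k k≤n′)))
      where k≤n′ = ≤-trans k≤n₁ n₁≤n′

module AlgorithmB {c ℓ v : Level} (F : Field c ℓ) {V : Set v} (S : Ops.Stratification F V)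
                  (D : List (Field.Carrier F)) (n₁ n′ : ℕ) (f : Field.Carrier F)
                  (σ : Field.Carrier F → Field.Carrier F) where
  open Field F hiding (zero)
  open Ops F
  open PowerSeries F
  open AlgB S D n₁ n′ f σ
  open import Relation.Binary.Reasoning.Setoid setoid
  open import Algebra.Properties.Ring ring using (-0#≈0#)

  -- the contributions of the two branches of the inner loop at index i, where h = f^i
  added : ℕ → ℕ → Carrier
  added k i = if does (i ≤? k) ∧ does (k ∸ i ≤? d ⊓ k) then (σ (P i) * coef D (d ∸ (k ∸ i))) * pow f i else 0#

  subtracted : (ℕ → Carrier) → ℕ → ℕ → Carrier
  subtracted prev k i = if does (1 ≤? i) ∧ does (i ≤? d ⊓ k) then (prev (k ∸ i) * σ (coef D i)) * pow f i else 0#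

  body-step : ∀ prev k i {M h s} → M ≈ s → h ≈ pow f i →
              (proj₁ (body prev k (M , h) i) ≈ s + (added k i - subtracted prev k i))
              × (proj₂ (body prev k (M , h) i) ≈ pow f (suc i))
  body-step prev k i {M} {h} {s} M≈s h≈fⁱ =
    cases (does (i ≤? k) ∧ does (k ∸ i ≤? d ⊓ k)) (does (1 ≤? i) ∧ does (i ≤? d ⊓ k)) , *-congʳ h≈fⁱ
    where
    X = σ (P i) * coef D (d ∸ (k ∸ i))
    Y = prev (k ∸ i) * σ (coef D i)
    x-0 : ∀ x → x - 0# ≈ x
    x-0 x = trans (+-congˡ -0#≈0#) (+-identityʳ x)
    cases : ∀ b₁ b₂ →
      (if b₂ then (if b₁ then M + X * h else M) - Y * h else (if b₁ then M + X * h else M))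
        ≈ s + ((if b₁ then X * pow f i else 0#) - (if b₂ then Y * pow f i else 0#))
    cases true  true  = trans (+-cong (+-cong M≈s (*-congˡ h≈fⁱ)) (-‿cong (*-congˡ h≈fⁱ))) (+-assoc _ _ _)
    cases true  false = trans (+-cong M≈s (*-congˡ h≈fⁱ)) (+-congˡ (sym (x-0 _)))
    cases false true  = trans (+-cong M≈s (-‿cong (*-congˡ h≈fⁱ))) (+-congˡ (sym (+-identityˡ _)))
    cases false false = trans M≈s (sym (trans (+-congˡ (x-0 0#)) (+-identityʳ s)))

  Mk-sum : ∀ prev k → Mk prev k ≈ sumTo k (λ i → added k i - subtracted prev k i)
  Mk-sum prev k = proj₁ (loop k)
    where
    Invariant : ℕ → Carrier × Carrier → Set ℓ
    Invariant t q = (proj₁ q ≈ sumTo t (λ i → added k i - subtracted prev k i)) × (proj₂ q ≈ pow f (suc t))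
    loop : ∀ t → Invariant t (foldl (body prev k) (0# , 1#) (upTo (suc t)))
    loop zero    = let M≈ , h≈ = body-step prev k 0 refl refl in trans M≈ (+-identityˡ _) , h≈
    loop (suc t) =
      ≡.subst (λ xs → Invariant (suc t) (foldl (body prev k) (0# , 1#) xs)) (Listₚ.upTo-∷ʳ (suc t))
        (≡.subst (Invariant (suc t)) (≡.sym (Listₚ.foldl-∷ʳ (body prev k) (0# , 1#) (suc t) (upTo (suc t))))
          (body-step prev k (suc t) (proj₁ (loop t)) (proj₂ (loop t))))

  M : ℕ → Carrier
  M k = Mk (coef (Ms k)) k

  length-Ms : ∀ k → length (Ms k) ≡ k
  length-Ms zero    = ≡.refl
  length-Ms (suc k) = ≡.trans (Listₚ.length-++ (Ms k)) (≡.trans (≡.cong (_+ℕ 1) (length-Ms k)) (ℕₚ.+-comm k 1))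

  coef-Ms : ∀ {K k} → k < K → coef (Ms K) k ≡ M k
  coef-Ms {suc K} {k} (s≤s k≤K) with ℕₚ.m≤n⇒m<n∨m≡n k≤K
  ... | inj₁ k<K    = ≡.trans (coef-++ˡ (Ms K) _ (≡.subst (k <_) (≡.sym (length-Ms K)) k<K)) (coef-Ms k<K)
  ... | inj₂ ≡.refl = ≡.subst (λ t → coef (Ms (suc k)) t ≡ M k) (length-Ms k) (coef-∷ʳ (Ms k) (M k))

  -- N_{n-k} for k ≤ m, with n written as p + k so that no truncated subtraction occurs
  module TopCoefficient (N : List Carrier) (ε : Carrier) (p k : ℕ)
           (σ-hom : IsFieldEndo σ) (D₀≈1 : coef D 0 ≈ 1#)
           (N-degree : ∀ i → p +ℕ k < i → coef N i ≈ 0#)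
           (functional-equation : mul (coef N) (dual σ f d D) (p +ℕ d) ≈ ε * mul (dual σ f (p +ℕ k) N) (coef D) (p +ℕ d))
           (P≈N : P ≈[ k ] coef N)
           (N≈εM : ∀ j → 1 ≤ j → j ≤ k → coef N (p +ℕ j) ≈ ε * M (k ∸ j)) where
    open RingMorphisms.IsRingHomomorphism σ-hom using (⟦⟧-cong; 1#-homo)

    lhsTerm rhsTerm : ℕ → Carrier
    lhsTerm j = coef N (p +ℕ j) * dual σ f d D (d ∸ j)
    rhsTerm j = dual σ f (p +ℕ k) N (p +ℕ j) * coef D (d ∸ j)

    d⊓k≤k : d ⊓ k ≤ k
    d⊓k≤k = ℕₚ.m⊓n≤n d k

    lhs-window : mul (coef N) (dual σ f d D) (p +ℕ d) ≈ sumTo (d ⊓ k) lhsTerm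
    lhs-window = mul-window p k d _ _ N-degree (λ i d<i → dual-> σ f d D d<i)

    rhs-window : mul (dual σ f (p +ℕ k) N) (coef D) (p +ℕ d) ≈ sumTo (d ⊓ k) rhsTerm
    rhs-window = mul-window p k d _ _ (λ i → dual-> σ f (p +ℕ k) N) (λ i → coef-beyond-deg D)

    dual-D : ∀ {j} → j ≤ d → dual σ f d D (d ∸ j) ≡ σ (coef D j) * pow f j
    dual-D {j} j≤d = ≡.trans (dual-≤ σ f d D (ℕₚ.m∸n≤m d j))
                       (≡.cong (λ t → σ (coef D t) * pow f t) (ℕₚ.m∸[m∸n]≡n j≤d))

    lhsTerm-0 : lhsTerm 0 ≈ coef N p
    lhsTerm-0 = begin
      coef N (p +ℕ 0) * dual σ f d D d   ≈⟨ *-cong (reflexive (≡.cong (coef N) (ℕₚ.+-identityʳ p))) (reflexive (dual-D z≤n)) ⟩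
      coef N p * (σ (coef D 0) * 1#)     ≈⟨ *-congˡ (trans (*-identityʳ _) (trans (⟦⟧-cong D₀≈1) 1#-homo)) ⟩
      coef N p * 1#                      ≈⟨ *-identityʳ _ ⟩
      coef N p                           ∎

    added-sum : sumTo k (added k) ≈ sumTo (d ⊓ k) rhsTerm
    added-sum = begin
      sumTo k (added k)                       ≈⟨ sumTo-reverse k (added k) ⟩
      sumTo k (λ j → added k (k ∸ j))         ≈⟨ sumTo-take _ d⊓k≤k vanish ⟩
      sumTo (d ⊓ k) (λ j → added k (k ∸ j))   ≈⟨ sumTo-cong (d ⊓ k) term ⟩
      sumTo (d ⊓ k) rhsTerm                   ∎
      where
      vanish : ∀ j → d ⊓ k < j → j ≤ k → added k (k ∸ j) ≈ 0#
      vanish j d⊓k<j j≤k rewrite ℕₚ.m∸[m∸n]≡n j≤k | dec-false (j ≤? d ⊓ k) (ℕₚ.<⇒≱ d⊓k<j)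
        with does (k ∸ j ≤? k)
      ... | true  = refl
      ... | false = refl
      term : ∀ j → j ≤ d ⊓ k → added k (k ∸ j) ≈ rhsTerm j
      term j j≤d⊓k rewrite ℕₚ.m∸[m∸n]≡n (≤-trans j≤d⊓k d⊓k≤k) | dec-true (j ≤? d ⊓ k) j≤d⊓k
                         | dec-true (k ∸ j ≤? k) (ℕₚ.m∸n≤m k j)
                         | dual-≤ σ f (p +ℕ k) N (ℕₚ.+-monoʳ-≤ p (≤-trans j≤d⊓k d⊓k≤k))
                         | ℕₚ.[m+n]∸[m+o]≡n∸o p k j = begin
        (σ (P (k ∸ j)) * coef D (d ∸ j)) * pow f (k ∸ j)       ≈⟨ *-congʳ (*-congʳ (⟦⟧-cong (P≈N (k ∸ j) (ℕₚ.m∸n≤m k j)))) ⟩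
        (σ (coef N (k ∸ j)) * coef D (d ∸ j)) * pow f (k ∸ j)  ≈⟨ trans (*-assoc _ _ _) (trans (*-congˡ (*-comm _ _)) (sym (*-assoc _ _ _))) ⟩
        (σ (coef N (k ∸ j)) * pow f (k ∸ j)) * coef D (d ∸ j)  ∎

    subtracted-sum : ε * sumTo k (subtracted (coef (Ms k)) k)
                     ≈ sumTo (d ⊓ k) (λ j → if does (1 ≤? j) then lhsTerm j else 0#)
    subtracted-sum = begin
      ε * sumTo k (subtracted (coef (Ms k)) k)                 ≈⟨ *-sumTo k ε _ ⟩
      sumTo k (λ j → ε * subtracted (coef (Ms k)) k j)         ≈⟨ sumTo-take _ d⊓k≤k (λ j d⊓k<j _ → trans (*-congˡ (vanish j d⊓k<j)) (zeroʳ ε)) ⟩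
      sumTo (d ⊓ k) (λ j → ε * subtracted (coef (Ms k)) k j)   ≈⟨ sumTo-cong (d ⊓ k) term ⟩
      sumTo (d ⊓ k) (λ j → if does (1 ≤? j) then lhsTerm j else 0#) ∎
      where
      vanish : ∀ j → d ⊓ k < j → subtracted (coef (Ms k)) k j ≈ 0#
      vanish j d⊓k<j rewrite dec-false (j ≤? d ⊓ k) (ℕₚ.<⇒≱ d⊓k<j) with does (1 ≤? j)
      ... | true  = refl
      ... | false = refl
      term : ∀ j → j ≤ d ⊓ k → ε * subtracted (coef (Ms k)) k j ≈ (if does (1 ≤? j) then lhsTerm j else 0#)
      term zero     _       = zeroʳ ε
      term (suc j₀) j≤d⊓k rewrite dec-true (suc j₀ ≤? d ⊓ k) j≤d⊓k
                                | coef-Ms {k} (ℕₚ.∸-monoʳ-< (s≤s z≤n) (≤-trans j≤d⊓k d⊓k≤k))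
                                | dual-D (≤-trans j≤d⊓k (ℕₚ.m⊓n≤m d k)) = begin
        ε * ((M (k ∸ j) * σ (coef D j)) * pow f j)   ≈⟨ trans (*-congˡ (*-assoc _ _ _)) (sym (*-assoc _ _ _)) ⟩
        (ε * M (k ∸ j)) * (σ (coef D j) * pow f j)   ≈⟨ *-congʳ (sym (N≈εM j (s≤s z≤n) (≤-trans j≤d⊓k d⊓k≤k))) ⟩
        coef N (p +ℕ j) * (σ (coef D j) * pow f j)   ∎
        where j = suc j₀

    top-coefficient : coef N p ≈ ε * M k
    top-coefficient = sym (begin
      ε * M k                                                ≈⟨ *-congˡ (Mk-sum (coef (Ms k)) k) ⟩
      ε * sumTo k (λ i → added k i - subtracted prev k i)    ≈⟨ *-congˡ (sumTo-- k _ _) ⟩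
      ε * (sumTo k (added k) - sumTo k (subtracted prev k))  ≈⟨ x[y-z]≈xy-xz ε _ _ ⟩
      ε * sumTo k (added k) - ε * sumTo k (subtracted prev k) ≈⟨ +-cong (*-congˡ added-sum) (-‿cong subtracted-sum) ⟩
      ε * sumTo (d ⊓ k) rhsTerm - higher                     ≈⟨ +-congʳ (*-congˡ rhs-window) ⟨
      ε * mul (dual σ f (p +ℕ k) N) (coef D) (p +ℕ d) - higher ≈⟨ +-congʳ functional-equation ⟨
      mul (coef N) (dual σ f d D) (p +ℕ d) - higher          ≈⟨ +-congʳ (trans lhs-window (sumTo-split-head (d ⊓ k) lhsTerm)) ⟩
      (lhsTerm 0 + higher) - higher                          ≈⟨ trans (+-assoc _ _ _) (trans (+-congˡ (-‿inverseʳ _)) (+-identityʳ _)) ⟩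
      lhsTerm 0                                              ≈⟨ lhsTerm-0 ⟩
      coef N p                                               ∎)
      where
      open import Algebra.Properties.Ring ring using (x[y-z]≈xy-xz)
      prev = coef (Ms k)
      higher = sumTo (d ⊓ k) (λ j → if does (1 ≤? j) then lhsTerm j else 0#)

  top-coefficients : ∀ (N : List Carrier) (n m : ℕ) (ε : Carrier) → IsFieldEndo σ →
    length N ≡ suc n → coef D 0 ≈ 1# →
    (∀ K → mul (coef N) (dual σ f d D) K ≈ ε * mul (dual σ f n N) (coef D) K) →
    P ≈[ m ] coef N → m ≤ n →
    ∀ k → k ≤ m → coef N (n ∸ k) ≈ ε * M k
  top-coefficients N n m ε σ-hom lenN D₀≈1 functional-equation P≈N m≤n =
    <-rec (λ k → k ≤ m → coef N (n ∸ k) ≈ ε * M k) λ k rec k≤m →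
      let k≤n  = ≤-trans k≤m m≤n
          p+k≡n = ℕₚ.m∸n+n≡m k≤n
      in TopCoefficient.top-coefficient N ε (n ∸ k) k σ-hom D₀≈1
           (λ i p+k<i → coef-beyond N (≡.subst (_≤ i) (≡.sym lenN) (≡.subst (_< i) p+k≡n p+k<i)))
           (≡.subst (λ t → mul (coef N) (dual σ f d D) ((n ∸ k) +ℕ d) ≈ ε * mul (dual σ f t N) (coef D) ((n ∸ k) +ℕ d))
                    (≡.sym p+k≡n) (functional-equation ((n ∸ k) +ℕ d)))
           (≈[]-weaken P≈N k≤m)
           (λ j 1≤j j≤k → trans (reflexive (≡.cong (coef N) (≡.sym (m∸[n∸o]≡m∸n+o j≤k k≤n))))
                                (rec (ℕₚ.∸-monoʳ-< 1≤j j≤k) (≤-trans (ℕₚ.m∸n≤m k j) k≤m)))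

proposition3p8 :
    ∀ {c ℓ v : Level} (F : Field c ℓ) →
    let open Field F
        open Ops F
    in
    {V : Set v} (S : Stratification V)
    (N D : List Carrier) (n d : ℕ) →
    length N ≡ suc n → ¬ (coef N n ≈ 0#) → coef N 0 ≈ 1# →
    length D ≡ suc d → ¬ (coef D d ≈ 0#) → coef D 0 ≈ 1# →
    (∀ k → mul (Lser S) (coef D) k ≈ coef N k) →
    (ε f : Carrier) (σ : Carrier → Carrier) → IsFieldEndo σ →
    (∀ k → mul (coef N) (dual σ f d D) k ≈ ε * mul (dual σ f n N) (coef D) k) →
    (m n' : ℕ) → m ≤ ⌊ n /2⌋ → ⌊ n /2⌋ ≤ n' → n' ≤ n →
    (proj₁ (algB S D m ⌊ n /2⌋ n' f σ) 0 ≈ 1#)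
    × (∀ k → n' < k → proj₁ (algB S D m ⌊ n /2⌋ n' f σ) k ≈ 0#)
    × (∀ k → k ≤ ⌊ n /2⌋ → proj₁ (algB S D m ⌊ n /2⌋ n' f σ) k ≈ coef N k)
    × (length (proj₂ (algB S D m ⌊ n /2⌋ n' f σ)) ≡ suc m)
    × (∀ k → k ≤ m → coef N (n ∸ k) ≈ ε * coef (proj₂ (algB S D m ⌊ n /2⌋ n' f σ)) k)
proposition3p8 F S N D n d lenN _ _ lenD _ D₀≈1 DL≈N ε f σ σ-hom functional-equation m n′ m≤n₁ n₁≤n′ n′≤n =
  algA-constant D n₁≤n′ D₀≈1 ,
  (λ k → algA-degree D n₁≤n′) ,
  P≈N ,
  length-Ms (suc m) ,
  λ k k≤m → trans (top-coefficients N n m ε σ-hom lenN D₀≈1 functional-equation′ (≈[]-weaken P≈N m≤n₁) m≤n k k≤m)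
                  (*-congˡ (reflexive (≡.sym (coef-Ms (s≤s k≤m)))))
  where
  open Field F hiding (zero)
  open Ops F
  open PowerSeries F
  open AlgorithmA F S
  n₁ = ⌊ n /2⌋
  open AlgorithmB F S D n₁ n′ f σ

  P≈N : algA S D 1 n₁ n′ ≈[ n₁ ] coef N
  P≈N = ≈[]-trans (algA-≈[]-mul-Lser D n₁≤n′) (λ k _ → DL≈N k)

  functional-equation′ : ∀ K → mul (coef N) (dual σ f (deg D) D) K ≈ ε * mul (dual σ f n N) (coef D) K
  functional-equation′ = ≡.subst (λ t → ∀ K → mul (coef N) (dual σ f t D) K ≈ ε * mul (dual σ f n N) (coef D) K)
                                 (≡.cong (_∸ 1) (≡.sym lenD)) functional-equation

  m≤n : m ≤ n
  m≤n = ≤-trans m≤n₁ (≤-trans n₁≤n′ n′≤n)
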